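{- Let $n$ be a positive integer. Every partition $x\in C_2(n)$ is either a Metropolis 2-partition of $n$ or an extension of some Metropolis 2-partition $y\vdash m$ with $m<n$.
   Context: A partition of a positive integer $n$ is identified with a non-negative integer point $x=(x_1,\dots,x_n)\in\mathbb{R}^n$ satisfying $x_1+2x_2+\dots+nx_n=n$, where $x_i$ is the number of parts equal to $i$; write $x\vdash n$. The polytope of partitions is $P_n=\mathrm{conv}\{x: x\vdash n\}$. A convex combination of points $y^1,\dots,y^k$ means $\sum_j\lambda_j y^j$ with all $\lambda_j>0$, $\sum_j\lambda_j=1$. $C_2(n)$ is the set of partitions $x\vdash n$ that are not vertices of $P_n$ and are convex combinations of two partitions of $n$ (different from $x$). For an even integer $m$, a Metropolis 2-partition of $m$ is a partition of $m$ obtained by joining (taking the union of the multisets of parts of) two, not necessarily different, partitions of $m/2$. A partition $x\vdash n$ is called an extension of a partition $y\vdash m$, $m<n$, if every part of $y$ is a part of $x$. -}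

module Defs where

open import Data.Nat using (ℕ; zero; suc; _+_; _*_; _≤_; _<_)
open import Data.Fin using (Fin; toℕ)
open import Data.Unit using (⊤)
open import Data.List using (List; []; _∷_)
open import Data.Product using (Σ; _×_; _,_; ∃; ∃-syntax)
open import Relation.Nullary using (¬_)
open import Relation.Binary.PropositionalEquality using (_≡_)

-- A point of ℕ^n is a function Fin n → ℕ; coordinate i (0-based) is
-- x_{i+1}, the number of parts equal to i+1.

sumF : ∀ {n} → (Fin n → ℕ) → ℕ
sumF {zero}  f = 0
sumF {suc n} f = f Fin.zero + sumF (λ i → f (Fin.suc i))

_⊢_ : ∀ {n} → (Fin n → ℕ) → ℕ → Set
_⊢_ {n} x m = sumF (λ i → suc (toℕ i) * x i) ≡ m

IsPartition : (n : ℕ) → (Fin n → ℕ) → Set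
IsPartition n x = x ⊢ n

-- multiplicity of the part (j+1) in x, as a dimension-independent function
-- (0 when j+1 exceeds the dimension)
mult : ∀ {n} → (Fin n → ℕ) → ℕ → ℕ
mult {zero}  x j       = 0
mult {suc n} x zero    = x Fin.zero
mult {suc n} x (suc j) = mult (λ i → x (Fin.suc i)) j

_≗ᵖ_ : ∀ {n} → (Fin n → ℕ) → (Fin n → ℕ) → Set
x ≗ᵖ y = ∀ i → x i ≡ y i

-- Convex combinations with (positive rational) weights, denominators cleared:
-- weights w_j > 0 (natural numbers), and (Σ w_j) · x = Σ w_j · y^j.
weightSum : ∀ {n} → List (ℕ × (Fin n → ℕ)) → ℕ
weightSum []             = 0
weightSum ((w , _) ∷ ys) = w + weightSum ys

combo : ∀ {n} → List (ℕ × (Fin n → ℕ)) → Fin n → ℕ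
combo []             i = 0
combo ((w , y) ∷ ys) i = w * y i + combo ys i

AllOthers : (n : ℕ) → (Fin n → ℕ) → List (ℕ × (Fin n → ℕ)) → Set
AllOthers n x []             = ⊤
AllOthers n x ((w , y) ∷ ys) = (0 < w) × IsPartition n y × ¬ (y ≗ᵖ x) × AllOthers n x ys

-- x is NOT a vertex of P_n = conv{partitions of n}: x is a convex combination of
-- (finitely many) partitions of n other than x.
NotVertex : (n : ℕ) → (Fin n → ℕ) → Set
NotVertex n x = ∃[ ys ] (0 < weightSum ys × AllOthers n x ys
                         × (∀ i → weightSum ys * x i ≡ combo ys i))

C₂ : (n : ℕ) → (Fin n → ℕ) → Set
C₂ n x = IsPartition n x × NotVertex n x ×
  (∃[ y ] ∃[ z ] (IsPartition n y × IsPartition n z × ¬ (y ≗ᵖ x) × ¬ (z ≗ᵖ x) ×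
     (∃[ a ] ∃[ b ] (0 < a × 0 < b ×
        (∀ i → (a + b) * x i ≡ a * y i + b * z i)))))

Metropolis2 : (m : ℕ) → (Fin m → ℕ) → Set
Metropolis2 m y = IsPartition m y ×
  (∃[ k ] (0 < k × m ≡ k + k ×
     (∃[ a ] ∃[ b ] (IsPartition k a × IsPartition k b ×
        (∀ j → mult y j ≡ mult a j + mult b j)))))

IsExtension : ∀ {n m} → (Fin n → ℕ) → (Fin m → ℕ) → Set
IsExtension x y = ∀ j → mult y j ≤ mult x j

module Submission where

open import Defs
open import Data.Nat using (ℕ; zero; suc; _+_; _*_; _∸_; _≤_; _<_; z≤n; s≤s; _≤?_; >-nonZero)
open import Data.Nat.Properties
open import Algebra.Properties.CommutativeSemigroup +-commutativeSemigroup using (interchange)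
open import Data.Fin using (Fin; toℕ)
import Data.Fin as Fin
open import Data.Product using (Σ; _×_; ∃-syntax; _,_)
open import Data.Sum using (_⊎_; inj₁; inj₂)
open import Relation.Nullary using (¬_; yes; no; contradiction)
open import Relation.Binary.PropositionalEquality
open import Function using (_∘_)

-- Write x = (a y + b z)/(a + b) with a ≥ b. Then a (y_j − x_j) = b (x_j − z_j) ≤ b x_j ≤ a x_j,
-- so y exceeds x by at most x_j in every part j. Since x and y both partition n, the excess
-- (y − x)⁺ and the deficit (x − y)⁺ have the same weight k, positive as y ≠ x: they are two
-- partitions of k. Their union |y − x| is bounded by x part by part, hence is a Metropolis
-- 2-partition of 2k ≤ n contained in x, and equal to x when 2k = n.

m∸n+n≡n∸m+m : ∀ m n → (m ∸ n) + n ≡ (n ∸ m) + m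
m∸n+n≡n∸m+m m n with ≤-total m n
... | inj₁ m≤n rewrite m≤n⇒m∸n≡0 m≤n = sym (m∸n+n≡m m≤n)
... | inj₂ n≤m rewrite m≤n⇒m∸n≡0 n≤m = m∸n+n≡m n≤m

m∸n≤n⇒m∸n+n∸m≤n : ∀ {m n} → m ∸ n ≤ n → (m ∸ n) + (n ∸ m) ≤ n
m∸n≤n⇒m∸n+n∸m≤n {m} {n} m∸n≤n with ≤-total m n
... | inj₁ m≤n rewrite m≤n⇒m∸n≡0 m≤n = m∸n≤m n m
... | inj₂ n≤m rewrite m≤n⇒m∸n≡0 n≤m | +-identityʳ (m ∸ n) = m∸n≤n

+-≤-≡⇒≡ : ∀ {a b c d} → a ≤ c → b ≤ d → a + b ≡ c + d → a ≡ c × b ≡ d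
+-≤-≡⇒≡ {a} {b} {c} {d} a≤c b≤d eq = a≡c , +-cancelˡ-≡ a b d (trans eq (cong (_+ d) (sym a≡c)))
  where
  a≡c : a ≡ c
  a≡c = ≤-antisym a≤c (+-cancelʳ-≤ b c a (subst (c + b ≤_) (sym eq) (+-monoʳ-≤ c b≤d)))

∸-≤-of-combination : ∀ a b {x y z} → 0 < b → b ≤ a → (a + b) * x ≡ a * y + b * z → y ∸ x ≤ x
∸-≤-of-combination a b {x} {y} {z} 0<b b≤a comb = *-cancelˡ-≤ b {{>-nonZero 0<b}} (begin
  b * (y ∸ x)      ≤⟨ *-monoˡ-≤ (y ∸ x) b≤a ⟩
  a * (y ∸ x)      ≡⟨ *-distribˡ-∸ a y x ⟩
  a * y ∸ a * x    ≤⟨ m≤n+o⇒m∸n≤o (a * y) (a * x) ay≤ax+bx ⟩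
  b * x            ∎)
  where
  open ≤-Reasoning
  ay≤ax+bx : a * y ≤ a * x + b * x
  ay≤ax+bx = begin
    a * y            ≤⟨ m≤m+n (a * y) (b * z) ⟩
    a * y + b * z    ≡⟨ sym comb ⟩
    (a + b) * x      ≡⟨ *-distribʳ-+ x a b ⟩
    a * x + b * x    ∎

VanishesFrom : ℕ → (ℕ → ℕ) → Set
VanishesFrom n f = ∀ j → n ≤ j → f j ≡ 0

vanishesFrom-tail : ∀ {n f} → VanishesFrom (suc n) f → VanishesFrom n (λ j → f (suc j))
vanishesFrom-tail v j n≤j = v (suc j) (s≤s n≤j)

excess : (ℕ → ℕ) → (ℕ → ℕ) → ℕ → ℕ
excess f g j = f j ∸ g j

vanishesFrom-excess : ∀ {n f g} → VanishesFrom n f → VanishesFrom n g → VanishesFrom n (excess f g)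
vanishesFrom-excess vf vg j n≤j rewrite vf j n≤j | vg j n≤j = refl

vanishesFrom-+ : ∀ {n f g} → VanishesFrom n f → VanishesFrom n g → VanishesFrom n (λ j → f j + g j)
vanishesFrom-+ vf vg j n≤j rewrite vf j n≤j | vg j n≤j = refl

mult-vanishesFrom : ∀ {n} (x : Fin n → ℕ) → VanishesFrom n (mult x)
mult-vanishesFrom {zero}  x j       n≤j       = refl
mult-vanishesFrom {suc n} x (suc j) (s≤s n≤j) = mult-vanishesFrom (λ i → x (Fin.suc i)) j n≤j

mult-toℕ : ∀ {n} (x : Fin n → ℕ) i → mult x (toℕ i) ≡ x i
mult-toℕ x Fin.zero    = refl
mult-toℕ x (Fin.suc i) = mult-toℕ (λ i → x (Fin.suc i)) i

mult-pointwise₂ : ∀ {n} (R : ℕ → ℕ → Set) → R 0 0 → {x y : Fin n → ℕ} →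
  (∀ i → R (x i) (y i)) → ∀ j → R (mult x j) (mult y j)
mult-pointwise₂ {zero}  R R00 r j       = R00
mult-pointwise₂ {suc n} R R00 r zero    = r Fin.zero
mult-pointwise₂ {suc n} R R00 r (suc j) = mult-pointwise₂ R R00 (λ i → r (Fin.suc i)) j

restrict : (m : ℕ) → (ℕ → ℕ) → Fin m → ℕ
restrict m f i = f (toℕ i)

mult-restrict : ∀ {m f} → VanishesFrom m f → ∀ j → mult (restrict m f) j ≡ f j
mult-restrict {zero}  v j       = sym (v j z≤n)
mult-restrict {suc m} v zero    = refl
mult-restrict {suc m} v (suc j) = mult-restrict (vanishesFrom-tail v) j

-- The weight Σ_{j<n} (o + j + 1) f j of a multiplicity function, with an offset o for the recursion
weightFrom : ℕ → ℕ → (ℕ → ℕ) → ℕ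
weightFrom o zero    f = 0
weightFrom o (suc n) f = suc o * f 0 + weightFrom (suc o) n (λ j → f (suc j))

weight : ℕ → (ℕ → ℕ) → ℕ
weight = weightFrom 0

sumF-cong : ∀ {n} {f g : Fin n → ℕ} → (∀ i → f i ≡ g i) → sumF f ≡ sumF g
sumF-cong {zero}  f≗g = refl
sumF-cong {suc n} f≗g = cong₂ _+_ (f≗g Fin.zero) (sumF-cong (λ i → f≗g (Fin.suc i)))

sumF≡weightFrom-mult : ∀ {n} o (x : Fin n → ℕ) →
  sumF (λ i → (o + suc (toℕ i)) * x i) ≡ weightFrom o n (mult x)
sumF≡weightFrom-mult {zero}  o x = refl
sumF≡weightFrom-mult {suc n} o x = cong₂ _+_ (cong (_* x Fin.zero) (+-comm o 1))
  (trans (sumF-cong (λ i → cong (_* x (Fin.suc i)) (+-suc o (suc (toℕ i)))))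
         (sumF≡weightFrom-mult (suc o) (λ i → x (Fin.suc i))))

weight-mult : ∀ {n m} (x : Fin n → ℕ) → x ⊢ m → weight n (mult x) ≡ m
weight-mult x x⊢m = trans (sym (sumF≡weightFrom-mult 0 x)) x⊢m

weightFrom-cong : ∀ n o {f g : ℕ → ℕ} → (∀ j → f j ≡ g j) → weightFrom o n f ≡ weightFrom o n g
weightFrom-cong zero    o f≗g = refl
weightFrom-cong (suc n) o f≗g =
  cong₂ _+_ (cong (suc o *_) (f≗g 0)) (weightFrom-cong n (suc o) (λ j → f≗g (suc j)))

weightFrom-+ : ∀ n o (f g : ℕ → ℕ) → weightFrom o n (λ j → f j + g j) ≡ weightFrom o n f + weightFrom o n g
weightFrom-+ zero    o f g = refl
weightFrom-+ (suc n) o f g = trans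
  (cong₂ _+_ (*-distribˡ-+ (suc o) (f 0) (g 0)) (weightFrom-+ n (suc o) (λ j → f (suc j)) (λ j → g (suc j))))
  (interchange (suc o * f 0) (suc o * g 0) _ _)

weightFrom-mono : ∀ n o {f g : ℕ → ℕ} → (∀ j → f j ≤ g j) → weightFrom o n f ≤ weightFrom o n g
weightFrom-mono zero    o f≤g = z≤n
weightFrom-mono (suc n) o f≤g =
  +-mono-≤ (*-monoʳ-≤ (suc o) (f≤g 0)) (weightFrom-mono n (suc o) (λ j → f≤g (suc j)))

term≤weightFrom : ∀ n o (f : ℕ → ℕ) j → j < n → suc (o + j) * f j ≤ weightFrom o n f
term≤weightFrom (suc n) o f zero    _ =
  subst (λ c → suc c * f 0 ≤ weightFrom o (suc n) f) (sym (+-identityʳ o)) (m≤m+n _ _)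
term≤weightFrom (suc n) o f (suc j) (s≤s j<n) =
  subst (λ c → suc c * f (suc j) ≤ weightFrom o (suc n) f) (sym (+-suc o j))
    (≤-trans (term≤weightFrom n (suc o) (λ j → f (suc j)) j j<n) (m≤n+m _ _))

weightFrom-≤-≡⇒≡ : ∀ n o {f g : ℕ → ℕ} → (∀ j → f j ≤ g j) →
  weightFrom o n f ≡ weightFrom o n g → ∀ j → j < n → f j ≡ g j
weightFrom-≤-≡⇒≡ (suc n) o {f} {g} f≤g eq j j<n
  with +-≤-≡⇒≡ (*-monoʳ-≤ (suc o) (f≤g 0)) (weightFrom-mono n (suc o) (λ j → f≤g (suc j))) eq
weightFrom-≤-≡⇒≡ (suc n) o {f} {g} f≤g eq zero    _         | heads , _ = *-cancelˡ-≡ (f 0) (g 0) (suc o) heads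
weightFrom-≤-≡⇒≡ (suc n) o {f} {g} f≤g eq (suc j) (s≤s j<n) | _ , tails =
  weightFrom-≤-≡⇒≡ n (suc o) (λ j → f≤g (suc j)) tails j j<n

weightFrom-vanishing : ∀ n o {f} → VanishesFrom 0 f → weightFrom o n f ≡ 0
weightFrom-vanishing zero    o v = refl
weightFrom-vanishing (suc n) o v rewrite v 0 z≤n | *-zeroʳ (suc o) =
  weightFrom-vanishing n (suc o) (λ j _ → v (suc j) z≤n)

weightFrom-truncate : ∀ n k o {f} → VanishesFrom n f → VanishesFrom k f → weightFrom o n f ≡ weightFrom o k f
weightFrom-truncate zero    k       o vn vk = sym (weightFrom-vanishing k o vn)
weightFrom-truncate (suc n) zero    o vn vk = weightFrom-vanishing (suc n) o vk
weightFrom-truncate (suc n) (suc k) o vn vk =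
  cong (suc o * _ +_) (weightFrom-truncate n k (suc o) (vanishesFrom-tail vn) (vanishesFrom-tail vk))

weightFrom-restrict : ∀ m o (f : ℕ → ℕ) → weightFrom o m (mult (restrict m f)) ≡ weightFrom o m f
weightFrom-restrict zero    o f = refl
weightFrom-restrict (suc m) o f = cong (suc o * f 0 +_) (weightFrom-restrict m (suc o) (λ j → f (suc j)))

-- A nonzero multiplicity at j contributes at least j + 1 to the weight.
vanishesFrom-weight : ∀ {n k f} → VanishesFrom n f → weight n f ≡ k → VanishesFrom k f
vanishesFrom-weight {n} {k} {f} v w≡k j k≤j with n ≤? j
... | yes n≤j = v j n≤j
... | no  n≰j with f j in fj
...   | zero  = refl
...   | suc p = contradiction (begin
          suc j           ≤⟨ m≤m*n (suc j) (suc p) ⟩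
          suc j * suc p   ≡⟨ cong (suc j *_) fj ⟨
          suc j * f j     ≤⟨ term≤weightFrom n 0 f j (≰⇒> n≰j) ⟩
          weight n f      ≡⟨ w≡k ⟩
          k               ≤⟨ k≤j ⟩
          j               ∎) (<⇒≱ ≤-refl)
  where open ≤-Reasoning

weight-≤-≡⇒≗ : ∀ {n f g} → VanishesFrom n f → VanishesFrom n g → (∀ j → f j ≤ g j) →
  weight n f ≡ weight n g → ∀ j → f j ≡ g j
weight-≤-≡⇒≗ {n} vf vg f≤g eq j with n ≤? j
... | yes n≤j = trans (vf j n≤j) (sym (vg j n≤j))
... | no  n≰j = weightFrom-≤-≡⇒≡ n 0 f≤g eq j (≰⇒> n≰j)

restrict-partition : ∀ {n k f} → VanishesFrom n f → weight n f ≡ k → IsPartition k (restrict k f)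
restrict-partition {n} {k} {f} v w≡k = begin
  sumF (λ i → suc (toℕ i) * restrict k f i)   ≡⟨ sumF≡weightFrom-mult 0 (restrict k f) ⟩
  weight k (mult (restrict k f))              ≡⟨ weightFrom-restrict k 0 f ⟩
  weight k f                                  ≡⟨ weightFrom-truncate n k 0 v (vanishesFrom-weight v w≡k) ⟨
  weight n f                                  ≡⟨ w≡k ⟩
  k                                           ∎
  where open ≡-Reasoning

weight-excess-comm : ∀ n f g → weight n f ≡ weight n g → weight n (excess f g) ≡ weight n (excess g f)
weight-excess-comm n f g eq = +-cancelʳ-≡ (weight n g) _ _ (begin
  weight n (excess f g) + weight n g        ≡⟨ weightFrom-+ n 0 (excess f g) g ⟨
  weight n (λ j → excess f g j + g j)      ≡⟨ weightFrom-cong n 0 (λ j → m∸n+n≡n∸m+m (f j) (g j)) ⟩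
  weight n (λ j → excess g f j + f j)      ≡⟨ weightFrom-+ n 0 (excess g f) f ⟩
  weight n (excess g f) + weight n f        ≡⟨ cong (weight n (excess g f) +_) eq ⟩
  weight n (excess g f) + weight n g        ∎)
  where open ≡-Reasoning

weight-excess-positive : ∀ {n f g} → VanishesFrom n f → VanishesFrom n g → weight n f ≡ weight n g →
  ¬ (∀ j → f j ≡ g j) → 0 < weight n (excess f g)
weight-excess-positive {n} {f} {g} vf vg eq f≢g = n≢0⇒n>0 λ w≡0 → f≢g (f≗g w≡0)
  where
  f≗g : weight n (excess f g) ≡ 0 → ∀ j → f j ≡ g j
  f≗g w≡0 j = begin
    f j                   ≡⟨ cong (_+ f j) gf≡0 ⟨
    excess g f j + f j    ≡⟨ m∸n+n≡n∸m+m (f j) (g j) ⟨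
    excess f g j + g j    ≡⟨ cong (_+ g j) fg≡0 ⟩
    g j                   ∎
    where
    open ≡-Reasoning
    fg≡0 : excess f g j ≡ 0
    fg≡0 = vanishesFrom-weight (vanishesFrom-excess vf vg) w≡0 j z≤n
    gf≡0 : excess g f j ≡ 0
    gf≡0 = vanishesFrom-weight (vanishesFrom-excess vg vf) (trans (sym (weight-excess-comm n f g eq)) w≡0) j z≤n

MetropolisOrExtension : (n : ℕ) → (Fin n → ℕ) → Set
MetropolisOrExtension n x =
  Metropolis2 n x ⊎ (∃[ m ] (m < n × (Σ (Fin m → ℕ) λ y → Metropolis2 m y × IsExtension x y)))

metropolis-union : ∀ {n m k} {u : Fin m → ℕ} {f g : ℕ → ℕ} → IsPartition m u → 0 < k → m ≡ k + k →
  VanishesFrom n f → weight n f ≡ k → VanishesFrom n g → weight n g ≡ k →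
  (∀ j → mult u j ≡ f j + g j) → Metropolis2 m u
metropolis-union {k = k} {f = f} {g} pu 0<k m≡2k vf wf vg wg u≗f+g =
  pu , k , 0<k , m≡2k , restrict k f , restrict k g , restrict-partition vf wf , restrict-partition vg wg ,
  λ j → trans (u≗f+g j)
    (sym (cong₂ _+_ (mult-restrict (vanishesFrom-weight vf wf) j) (mult-restrict (vanishesFrom-weight vg wg) j)))

metropolis-or-extension-of-union : ∀ {n k} {x : Fin n → ℕ} {f g : ℕ → ℕ} → IsPartition n x → 0 < k →
  VanishesFrom n f → weight n f ≡ k → VanishesFrom n g → weight n g ≡ k →
  (∀ j → f j + g j ≤ mult x j) → MetropolisOrExtension n x
metropolis-or-extension-of-union {n} {k} {x} {f} {g} px 0<k vf wf vg wg u≤x = by-cases (m≤n⇒m<n∨m≡n 2k≤n)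
  where
  u : ℕ → ℕ
  u j = f j + g j
  vu : VanishesFrom n u
  vu = vanishesFrom-+ vf vg
  wu : weight n u ≡ k + k
  wu = trans (weightFrom-+ n 0 f g) (cong₂ _+_ wf wg)
  2k≤n : k + k ≤ n
  2k≤n = subst₂ _≤_ wu (weight-mult x px) (weightFrom-mono n 0 u≤x)
  mult-restrict-u : ∀ j → mult (restrict (k + k) u) j ≡ u j
  mult-restrict-u = mult-restrict (vanishesFrom-weight vu wu)
  by-cases : k + k < n ⊎ k + k ≡ n → MetropolisOrExtension n x
  by-cases (inj₂ 2k≡n) = inj₁ (metropolis-union px 0<k (sym 2k≡n) vf wf vg wg λ j →
    sym (weight-≤-≡⇒≗ vu (mult-vanishesFrom x) u≤x (trans wu (trans 2k≡n (sym (weight-mult x px)))) j))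
  by-cases (inj₁ 2k<n) = inj₂ (k + k , 2k<n , restrict (k + k) u ,
    metropolis-union (restrict-partition vu wu) 0<k refl vf wf vg wg mult-restrict-u ,
    λ j → subst (_≤ mult x j) (sym (mult-restrict-u j)) (u≤x j))

mult-injective : ∀ {n} {x y : Fin n → ℕ} → (∀ j → mult x j ≡ mult y j) → x ≗ᵖ y
mult-injective {x = x} {y} x≗y i = trans (sym (mult-toℕ x i)) (trans (x≗y (toℕ i)) (mult-toℕ y i))

metropolis-or-extension : ∀ {n} {x y : Fin n → ℕ} → IsPartition n x → IsPartition n y → ¬ (y ≗ᵖ x) →
  (∀ i → y i ∸ x i ≤ x i) → MetropolisOrExtension n x
metropolis-or-extension {n} {x} {y} px py y≢x y∸x≤x =
  metropolis-or-extension-of-union px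
    (weight-excess-positive vY vX wY≡wX (y≢x ∘ mult-injective))
    (vanishesFrom-excess vY vX) refl
    (vanishesFrom-excess vX vY) (sym (weight-excess-comm n (mult y) (mult x) wY≡wX))
    (λ j → m∸n≤n⇒m∸n+n∸m≤n (mult-pointwise₂ (λ b a → b ∸ a ≤ a) z≤n y∸x≤x j))
  where
  vX : VanishesFrom n (mult x)
  vX = mult-vanishesFrom x
  vY : VanishesFrom n (mult y)
  vY = mult-vanishesFrom y
  wY≡wX : weight n (mult y) ≡ weight n (mult x)
  wY≡wX = trans (weight-mult y py) (sym (weight-mult x px))

theorem5 : (n : ℕ) → 0 < n → (x : Fin n → ℕ) → C₂ n x →
    Metropolis2 n x ⊎
    (∃[ m ] (m < n × (Σ (Fin m → ℕ) λ y → Metropolis2 m y × IsExtension x y)))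
theorem5 n _ x (px , _ , y , z , py , pz , y≢x , z≢x , a , b , 0<a , 0<b , comb) with b ≤? a
... | yes b≤a = metropolis-or-extension px py y≢x λ i → ∸-≤-of-combination a b 0<b b≤a (comb i)
... | no  b≰a = metropolis-or-extension px pz z≢x λ i → ∸-≤-of-combination b a 0<a (≰⇒≥ b≰a) (swap (comb i))
  where
  swap : ∀ {t u v} → (a + b) * t ≡ a * u + b * v → (b + a) * t ≡ b * v + a * u
  swap {t} {u} {v} eq = trans (cong (_* t) (+-comm b a)) (trans eq (+-comm (a * u) (b * v)))
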